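{- Let $m$ and $M$ be two positive integers. If $\mathsf{D}(\llbracket -m,M \rrbracket ) = m+M-1$, then $\rho (m,M)=1$, and every minimal zero-sum sequence over $\llbracket -m,M \rrbracket$ of length $m+M-1$ is one of the following two sequences: (i) $M^{m-1} \cdot (-(m-1))^M$, which occurs only if $\gcd(m-1,M)=1$; (ii) $(M-1)^{m} \cdot (-m)^{M-1}$, which occurs only if $\gcd(m, M-1)=1$.
   Context: Sequences of integers are unordered finite multisets written multiplicatively: $x^a$ denotes $a$ copies of $x$, $\cdot$ denotes concatenation; the length is the number of elements with multiplicity. $S=s_1\cdots s_n$ is a zero-sum sequence if $\sum s_i=0$, and minimal if moreover $\sum_{i\in I}s_i\ne0$ for every non-empty proper $I\subsetneq\{1,\dots,n\}$. A sequence is over a set $A$ if all its elements lie in $A$. For integers $a\le b$, $\llbracket a,b\rrbracket$ is the set of integers between $a$ and $b$. $\mathsf{D}(\llbracket -m,M\rrbracket)$ is the maximal length of a minimal zero-sum sequence over $\llbracket -m,M\rrbracket$. Define $\rho(m,M)=\min\{t\in\mathbb{Z}_{\ge 0} : \exists\, t'\in\mathbb{Z},\ 0\le t'\le t,\ \gcd(M-t',\,m-(t-t'))=1\}$. -}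

module Defs where

open import Data.Nat as ℕ using (ℕ; _∸_)
open import Data.Integer as ℤ using (ℤ; +_; -_; _-_)
open import Data.Integer.GCD using (gcd)
open import Data.List using (List; []; length; replicate; _++_; foldr)
open import Data.List.Relation.Unary.All using (All)
open import Data.List.Relation.Binary.Sublist.Propositional using (_⊆_)
open import Data.Product using (Σ; _×_; ∃-syntax)
open import Relation.Binary.PropositionalEquality using (_≡_)
open import Relation.Nullary using (¬_)

-- A sequence (finite unordered multiset) of integers is represented by a list;
-- sequences are compared up to permutation (_↭_) where needed.
Sequence : Set
Sequence = List ℤ

Over : ℤ → ℤ → Sequence → Set
Over a b S = All (λ x → a ℤ.≤ x × x ℤ.≤ b) S

sumℤ : Sequence → ℤ
sumℤ = foldr ℤ._+_ ℤ.0ℤ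

ZeroSum : Sequence → Set
ZeroSum S = sumℤ S ≡ ℤ.0ℤ

-- sub-multisets of S correspond to sublists of S; a subsequence T ⊆ S is a
-- non-empty proper one iff 0 < length T < length S.
MinimalZeroSum : Sequence → Set
MinimalZeroSum S =
  ZeroSum S ×
  ((T : Sequence) → T ⊆ S → 0 ℕ.< length T → length T ℕ.< length S → ¬ ZeroSum T)

DavenportIs : ℕ → ℕ → ℕ → Set
DavenportIs m M d =
  (∃[ S ] (Over (- (+ m)) (+ M) S × MinimalZeroSum S × length S ≡ d)) ×
  ((S : Sequence) → Over (- (+ m)) (+ M) S → MinimalZeroSum S → length S ℕ.≤ d)

RhoCond : ℕ → ℕ → ℕ → Set
RhoCond m M t = ∃[ t' ] (t' ℕ.≤ t × gcd (+ M - + t') (+ m - + (t ∸ t')) ≡ + 1)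

RhoIs : ℕ → ℕ → ℕ → Set
RhoIs m M r = RhoCond m M r × ((t : ℕ) → t ℕ.< r → ¬ RhoCond m M t)

_^^_ : ℤ → ℕ → Sequence
x ^^ a = replicate a x

-- Write a minimal zero-sum sequence over ⟦-m, M⟧ as ps · (-qs) with ps ⊆ [1, M], qs ⊆ [1, m];
-- minimality says that no non-empty proper pair of sublists of ps and qs has equal sums.
-- Each prefix sum of qs is overshot by the next prefix sum of ps by an amount in [1, M], and
-- equal overshoots would give balanced segments, so |qs| ≤ M and likewise |ps| ≤ m.  If |qs| = M
-- the overshoot M occurs, and that forces the first element of ps to be M; as ps may be reordered,
-- ps = M^(m-1).  Then the prefix sums of qs, in any order, are pairwise incongruent mod M, so the
-- elements of qs are congruent to each other and coprime to M.  Since gcd(m, M) ≠ 1 (otherwise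
-- M^m · (-m)^M would be a longer minimal zero-sum sequence), m ∉ qs, and the sum (m-1)M forces
-- qs = (m-1)^M.  So ρ(m, M) ≠ 0, and the extremal sequence shows ρ(m, M) = 1.
module Submission where

open import Defs
open import Data.Nat as ℕ using (ℕ; _∸_; _+_)
open import Data.Integer as ℤ using (ℤ; +_; -_)
open import Data.Integer.GCD using (gcd)
open import Data.List using (List; length; _++_)
open import Data.List.Relation.Binary.Permutation.Propositional using (_↭_)
open import Data.Product using (_×_)
open import Data.Sum using (_⊎_)
open import Relation.Binary.PropositionalEquality using (_≡_)

open import Level using (Level)
open import Function using (_∘_)
open import Data.Empty using (⊥)
open import Data.Product using (∃-syntax; _,_; proj₁; proj₂)
open import Data.Sum using (inj₁; inj₂)
import Data.Sum as Sum
open import Relation.Nullary using (¬_; Dec; yes; no; contradiction)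
open import Relation.Binary.Definitions using (tri<; tri≈; tri>)
open import Relation.Binary.PropositionalEquality
  using (_≢_; refl; sym; trans; cong; cong₂; subst; subst₂; setoid; module ≡-Reasoning)

open import Data.Nat
  using (zero; suc; _*_; _≤_; _<_; _≤?_; _<?_; z≤n; s≤s; z<s; NonZero; ≢-nonZero; ≢-nonZero⁻¹; >-nonZero)
open import Data.Nat.Properties
open import Data.Nat.Tactic.RingSolver using (solve-∀)
open import Data.Nat.ListAction using (sum)
open import Data.Nat.ListAction.Properties using (sum-↭)
open import Data.Nat.DivMod using (_%_; _/_; m≡m%n+[m/n]*n; /-monoˡ-≤; m%n<n; %-distribˡ-+; m*n%n≡0)
open import Data.Nat.Divisibility using (_∣_; divides; n∣m⇒m%n≡0; ∣⇒≤)
open import Data.Nat.GCD using (gcd[m,n]∣m; gcd[m,n]∣n; gcd[m,n]≢0; gcd-zeroˡ)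
  renaming (gcd to gcdℕ; gcd-comm to gcdℕ-comm)
open import Data.Nat.Coprimality using (gcd≡1⇒coprime; coprime-divisor)
open import Data.Integer using (0ℤ; -[1+_]; +[1+_])
import Data.Integer.Properties as ℤ
open import Data.Integer.GCD using () renaming (gcd-comm to gcdℤ-comm)
open import Data.Fin using (Fin; fromℕ<; toℕ)
import Data.Fin.Properties as Fin

open import Data.List using ([]; _∷_; [_]; map; replicate; take; drop)
open import Data.List.Properties
  using (length-map; length-++; length-take; length-drop; length-replicate; take-all; map-replicate)
open import Data.List.Membership.Propositional using (_∈_)
open import Data.List.Membership.Propositional.Properties using (∈-∃++)
open import Data.List.Relation.Unary.All using (All; []; _∷_)
import Data.List.Relation.Unary.All as All
import Data.List.Relation.Unary.All.Properties as All
open import Data.List.Relation.Binary.Sublist.Propositional using (_⊆_; []; _∷_; _∷ʳ_; ⊆-trans; from∈)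
open import Data.List.Relation.Binary.Sublist.Propositional.Properties
  using (take-⊆; drop-⊆; ++⁺; map⁺; length-mono-≤)
open import Data.List.Relation.Binary.Permutation.Propositional
  using (↭-refl; ↭-sym; ↭-trans; prep; swap; ↭⇒↭ₛ)
  renaming (refl to ↭-refl′; trans to ↭-trans′)
open import Data.List.Relation.Binary.Permutation.Propositional.Properties
  using (↭-length; shift; All-resp-↭)
open import Data.List.Relation.Binary.Permutation.Setoid.Properties using (foldr-commMonoid)

private
  variable
    a : Level
    A B : Set a

-- Sublists and permutations

⊆-↭-commute : {xs ys zs : List A} → xs ↭ ys → zs ⊆ xs → ∃[ ws ] (ws ⊆ ys × ws ↭ zs)
⊆-↭-commute ↭-refl′ τ = _ , τ , ↭-refl
⊆-↭-commute (prep x p) (.x ∷ʳ τ) =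
  let ws , σ , π = ⊆-↭-commute p τ in ws , x ∷ʳ σ , π
⊆-↭-commute (prep x p) (refl ∷ τ) =
  let ws , σ , π = ⊆-↭-commute p τ in x ∷ ws , refl ∷ σ , prep x π
⊆-↭-commute (swap x y p) (.x ∷ʳ .y ∷ʳ τ) =
  let ws , σ , π = ⊆-↭-commute p τ in ws , y ∷ʳ x ∷ʳ σ , π
⊆-↭-commute (swap x y p) (.x ∷ʳ refl ∷ τ) =
  let ws , σ , π = ⊆-↭-commute p τ in y ∷ ws , refl ∷ x ∷ʳ σ , prep y π
⊆-↭-commute (swap x y p) (refl ∷ .y ∷ʳ τ) =
  let ws , σ , π = ⊆-↭-commute p τ in x ∷ ws , y ∷ʳ refl ∷ σ , prep x π
⊆-↭-commute (swap x y p) (refl ∷ refl ∷ τ) =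
  let ws , σ , π = ⊆-↭-commute p τ in y ∷ x ∷ ws , refl ∷ refl ∷ σ , swap y x π
⊆-↭-commute (↭-trans′ p q) τ =
  let ws , σ , π = ⊆-↭-commute p τ
      vs , σ′ , π′ = ⊆-↭-commute q σ
  in vs , σ′ , ↭-trans π′ π

⊆-++⁻ : ∀ (xs : List A) {ys zs} → zs ⊆ xs ++ ys →
  ∃[ as ] ∃[ bs ] (as ⊆ xs × bs ⊆ ys × zs ≡ as ++ bs)
⊆-++⁻ [] τ = [] , _ , [] , τ , refl
⊆-++⁻ (x ∷ xs) (.x ∷ʳ τ) =
  let as , bs , σ , σ′ , e = ⊆-++⁻ xs τ in as , bs , x ∷ʳ σ , σ′ , e
⊆-++⁻ (x ∷ xs) (refl ∷ τ) =
  let as , bs , σ , σ′ , e = ⊆-++⁻ xs τ in x ∷ as , bs , refl ∷ σ , σ′ , cong (x ∷_) e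

⊆-map⁻ : ∀ (f : A → B) {xs ys} → ys ⊆ map f xs → ∃[ zs ] (zs ⊆ xs × ys ≡ map f zs)
⊆-map⁻ f {[]} [] = [] , [] , refl
⊆-map⁻ f {x ∷ xs} (.(f x) ∷ʳ τ) =
  let zs , σ , e = ⊆-map⁻ f τ in zs , x ∷ʳ σ , e
⊆-map⁻ f {x ∷ xs} (refl ∷ τ) =
  let zs , σ , e = ⊆-map⁻ f τ in x ∷ zs , refl ∷ σ , cong (f x ∷_) e

∈⇒↭-front : ∀ {x : A} {xs} → x ∈ xs → ∃[ ys ] (xs ↭ x ∷ ys)
∈⇒↭-front {x = x} x∈xs with as , bs , refl ← ∈-∃++ x∈xs = as ++ bs , shift x as bs

-- Sums and prefix sums

sum-replicate : ∀ n x → sum (replicate n x) ≡ n * x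
sum-replicate zero x = refl
sum-replicate (suc n) x = cong (_+_ x) (sum-replicate n x)

sum-⊆-replicate : ∀ {n x as} → as ⊆ replicate n x → sum as ≡ length as * x
sum-⊆-replicate {zero} [] = refl
sum-⊆-replicate {suc n} (_ ∷ʳ as⊆) = sum-⊆-replicate as⊆
sum-⊆-replicate {suc n} (refl ∷ as⊆) = cong (_+_ _) (sum-⊆-replicate as⊆)

sum≤length* : ∀ {c} xs → All (_≤ c) xs → sum xs ≤ length xs * c
sum≤length* [] [] = z≤n
sum≤length* (_ ∷ xs) (x≤c ∷ xs≤c) = +-mono-≤ x≤c (sum≤length* xs xs≤c)

sum≡length*⇒All≡ : ∀ {c} xs → All (_≤ c) xs → sum xs ≡ length xs * c → All (_≡ c) xs
sum≡length*⇒All≡ [] [] _ = []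
sum≡length*⇒All≡ {c} (x ∷ xs) (x≤c ∷ xs≤c) Σ≡ = x≡c ∷ sum≡length*⇒All≡ xs xs≤c Σxs≡
  where
  c≤x : c ≤ x
  c≤x = +-cancelʳ-≤ (sum xs) c x
          (subst (c + sum xs ≤_) (sym Σ≡) (+-monoʳ-≤ c (sum≤length* xs xs≤c)))
  x≡c : x ≡ c
  x≡c = ≤-antisym x≤c c≤x
  Σxs≡ : sum xs ≡ length xs * c
  Σxs≡ = +-cancelˡ-≡ c _ _ (subst (λ z → z + sum xs ≡ c + length xs * c) x≡c Σ≡)

All≡⇒≡replicate : ∀ {x : A} xs → All (_≡ x) xs → xs ≡ replicate (length xs) x
All≡⇒≡replicate [] [] = refl
All≡⇒≡replicate (_ ∷ xs) (refl ∷ xs≡x) = cong (_ ∷_) (All≡⇒≡replicate xs xs≡x)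

prefixSum : List ℕ → ℕ → ℕ
prefixSum xs i = sum (take i xs)

prefixSum-+ : ∀ xs i k → prefixSum xs (i + k) ≡ prefixSum xs i + sum (take k (drop i xs))
prefixSum-+ xs zero k = refl
prefixSum-+ [] (suc i) zero = refl
prefixSum-+ [] (suc i) (suc k) = refl
prefixSum-+ (x ∷ xs) (suc i) k =
  trans (cong (_+_ x) (prefixSum-+ xs i k)) (sym (+-assoc x _ _))

length-take-drop : ∀ (xs : List A) i k → i + k ≤ length xs → length (take k (drop i xs)) ≡ k
length-take-drop xs i k i+k≤ = begin
  length (take k (drop i xs)) ≡⟨ length-take k (drop i xs) ⟩
  k ℕ.⊓ length (drop i xs)    ≡⟨ cong (k ℕ.⊓_) (length-drop i xs) ⟩
  k ℕ.⊓ (length xs ∸ i)       ≡⟨ m≤n⇒m⊓n≡m k≤ ⟩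
  k                           ∎
  where
  open ≡-Reasoning
  k≤ : k ≤ length xs ∸ i
  k≤ = m+n≤o⇒m≤o∸n k (subst (_≤ length xs) (+-comm i k) i+k≤)

prefixSum-mono-≤ : ∀ xs {i j} → i ≤ j → prefixSum xs i ≤ prefixSum xs j
prefixSum-mono-≤ xs {zero} _ = z≤n
prefixSum-mono-≤ [] {suc i} {suc j} _ = ≤-refl
prefixSum-mono-≤ (x ∷ xs) {suc i} {suc j} (s≤s i≤j) = +-monoʳ-≤ x (prefixSum-mono-≤ xs i≤j)

prefixSum-mono-< : ∀ {xs i j} → All (0 <_) xs → i < j → j ≤ length xs →
  prefixSum xs i < prefixSum xs j
prefixSum-mono-< {x ∷ xs} {zero} {suc j} (x>0 ∷ _) _ _ = ≤-trans x>0 (m≤m+n x _)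
prefixSum-mono-< {x ∷ xs} {suc i} {suc j} (_ ∷ xs>0) (s≤s i<j) (s≤s j≤) =
  +-monoʳ-< x (prefixSum-mono-< xs>0 i<j j≤)

prefixSum-length : ∀ xs → prefixSum xs (length xs) ≡ sum xs
prefixSum-length xs = cong sum (take-all (length xs) xs ≤-refl)

prefixSum-suc-≤ : ∀ {B xs} i → All (_≤ B) xs → prefixSum xs (suc i) ≤ prefixSum xs i + B
prefixSum-suc-≤ i [] = z≤n
prefixSum-suc-≤ {B} zero (x≤B ∷ _) = subst (_≤ B) (sym (+-identityʳ _)) x≤B
prefixSum-suc-≤ {B} {x ∷ xs} (suc i) (_ ∷ xs≤B) =
  subst (x + prefixSum xs (suc i) ≤_) (sym (+-assoc x _ B)) (+-monoʳ-≤ x (prefixSum-suc-≤ i xs≤B))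

prefixSum-replicate : ∀ {w t} x → t ≤ w → prefixSum (replicate w x) t ≡ t * x
prefixSum-replicate {t = zero} x _ = refl
prefixSum-replicate {suc w} {suc t} x (s≤s t≤w) = cong (_+_ x) (prefixSum-replicate x t≤w)

NoProperBalance : List ℕ → List ℕ → Set
NoProperBalance ps qs =
  ∀ {as bs} → as ⊆ ps → bs ⊆ qs → sum as ≡ sum bs →
  length as + length bs < length ps + length qs → length as + length bs ≡ 0

noProperBalance-sym : ∀ {ps qs} → NoProperBalance ps qs → NoProperBalance qs ps
noProperBalance-sym {ps} {qs} npb {as} {bs} as⊆ bs⊆ Σas≡Σbs short =
  trans (+-comm (length as) (length bs))
    (npb bs⊆ as⊆ (sym Σas≡Σbs) (subst₂ _<_ (+-comm (length as) _) (+-comm (length qs) _) short))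

noProperBalance-resp-↭ : ∀ {ps ps′ qs qs′} → ps ↭ ps′ → qs ↭ qs′ →
  NoProperBalance ps qs → NoProperBalance ps′ qs′
noProperBalance-resp-↭ ps↭ qs↭ npb as⊆ bs⊆ Σas≡Σbs
  with as′ , as′⊆ , as′↭as ← ⊆-↭-commute (↭-sym ps↭) as⊆
     | bs′ , bs′⊆ , bs′↭bs ← ⊆-↭-commute (↭-sym qs↭) bs⊆
  rewrite sym (↭-length as′↭as) | sym (↭-length bs′↭bs)
        | sym (↭-length ps↭) | sym (↭-length qs↭)
  = npb as′⊆ bs′⊆ (trans (sum-↭ as′↭as) (trans Σas≡Σbs (sym (sum-↭ bs′↭bs))))

balanced-segments⇒empty : ∀ {ps qs} i k j l → NoProperBalance ps qs →
  i + k ≤ length ps → j + l < length qs →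
  prefixSum ps (i + k) + prefixSum qs j ≡ prefixSum ps i + prefixSum qs (j + l) → k + l ≡ 0
balanced-segments⇒empty {ps} {qs} i k j l npb i+k≤ j+l< eq =
  subst₂ (λ u v → u + v ≡ 0) |as| |bs|
    (npb (⊆-trans (take-⊆ k _) (drop-⊆ i ps)) (⊆-trans (take-⊆ l _) (drop-⊆ j qs))
         Σas≡Σbs short)
  where
  as bs : List ℕ
  as = take k (drop i ps)
  bs = take l (drop j qs)
  P Q : ℕ
  P = prefixSum ps i
  Q = prefixSum qs j
  |as| : length as ≡ k
  |as| = length-take-drop ps i k i+k≤
  |bs| : length bs ≡ l
  |bs| = length-take-drop qs j l (<⇒≤ j+l<)
  short : length as + length bs < length ps + length qs
  short = subst₂ (λ u v → u + v < length ps + length qs) (sym |as|) (sym |bs|)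
    (+-mono-≤-< (m+n≤o⇒n≤o i i+k≤) (≤-<-trans (m≤n+m l j) j+l<))
  open ≡-Reasoning
  Σas≡Σbs : sum as ≡ sum bs
  Σas≡Σbs = +-cancelʳ-≡ Q _ _ (+-cancelˡ-≡ P _ _ (begin
    P + (sum as + Q)                   ≡⟨ sym (+-assoc P _ Q) ⟩
    P + sum as + Q                     ≡⟨ cong (_+ Q) (sym (prefixSum-+ ps i k)) ⟩
    prefixSum ps (i + k) + Q           ≡⟨ eq ⟩
    P + prefixSum qs (j + l)           ≡⟨ cong (_+_ P) (trans (prefixSum-+ qs j l) (+-comm Q _)) ⟩
    P + (sum bs + Q)                   ∎))

balanced-prefixes⇒equal : ∀ {ps qs i i′ j j′} → NoProperBalance ps qs →
  i ≤ i′ → i′ ≤ length ps → j ≤ j′ → j′ < length qs →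
  prefixSum ps i′ + prefixSum qs j ≡ prefixSum ps i + prefixSum qs j′ → i ≡ i′ × j ≡ j′
balanced-prefixes⇒equal {i = i} {j = j} npb i≤i′ i′≤ j≤j′ j′< eq
  with k , refl ← m≤n⇒∃[o]m+o≡n i≤i′ | l , refl ← m≤n⇒∃[o]m+o≡n j≤j′
  with k+l≡0 ← balanced-segments⇒empty i k j l npb i′≤ j′< eq
  with refl ← m+n≡0⇒m≡0 k k+l≡0 | refl ← m+n≡0⇒n≡0 k k+l≡0
  = sym (+-identityʳ i) , sym (+-identityʳ j)

coprime⇒noProperBalance : ∀ {m M} .{{_ : NonZero m}} → gcdℕ m M ≡ 1 →
  NoProperBalance (replicate m M) (replicate M m)
coprime⇒noProperBalance {m} {M} coprime {as} {bs} as⊆ bs⊆ Σas≡Σbs short =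
  by-cases (length as ℕ.≟ 0)
  where
  |as|*M≡|bs|*m : length as * M ≡ length bs * m
  |as|*M≡|bs|*m = trans (sym (sum-⊆-replicate as⊆)) (trans Σas≡Σbs (sum-⊆-replicate bs⊆))
  m∣|as| : m ∣ length as
  m∣|as| = coprime-divisor (gcd≡1⇒coprime coprime)
             (divides (length bs) (trans (*-comm M _) |as|*M≡|bs|*m))
  by-cases : Dec (length as ≡ 0) → length as + length bs ≡ 0
  by-cases (yes |as|≡0) = trans (cong (_+ length bs) |as|≡0)
    (m*n≡0⇒m≡0 (length bs) m (trans (sym |as|*M≡|bs|*m) (cong (_* M) |as|≡0)))
  by-cases (no |as|≢0) = contradiction short
    (<-irrefl (cong₂ _+_ (trans |as|≡m (sym (length-replicate m)))
                         (trans |bs|≡M (sym (length-replicate M)))))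
    where
    |as|≡m : length as ≡ m
    |as|≡m = ≤-antisym (subst (length as ≤_) (length-replicate m) (length-mono-≤ as⊆))
                       (∣⇒≤ {{≢-nonZero |as|≢0}} m∣|as|)
    |bs|≡M : length bs ≡ M
    |bs|≡M = *-cancelʳ-≡ (length bs) M m
               (trans (sym |as|*M≡|bs|*m) (trans (cong (_* M) |as|≡m) (*-comm m M)))

-- Length bounds

injective⇒≤-ℕ : ∀ {n B} (f : ℕ → ℕ) → (∀ {i} → i < n → f i < B) →
  (∀ {i j} → i < j → j < n → f i ≢ f j) → n ≤ B
injective⇒≤-ℕ {n} {B} f f<B f-injective = Fin.injective⇒≤ g-injective
  where
  g : Fin n → Fin B
  g i = fromℕ< (f<B (Fin.toℕ<n i))
  f≡g : ∀ i → f (toℕ i) ≡ toℕ (g i)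
  f≡g i = sym (Fin.toℕ-fromℕ< (f<B (Fin.toℕ<n i)))
  g-injective : ∀ {i j} → g i ≡ g j → i ≡ j
  g-injective {i} {j} gi≡gj with <-cmp (toℕ i) (toℕ j)
  ... | tri< i<j _ _ = contradiction (trans (f≡g i) (trans (cong toℕ gi≡gj) (sym (f≡g j))))
                         (f-injective i<j (Fin.toℕ<n j))
  ... | tri≈ _ i≡j _ = Fin.toℕ-injective i≡j
  ... | tri> _ _ j<i = contradiction (trans (f≡g j) (trans (cong toℕ (sym gi≡gj)) (sym (f≡g i))))
                         (f-injective j<i (Fin.toℕ<n i))

crossing : List ℕ → ℕ → ℕ
crossing [] x = 0
crossing (y ∷ ys) x with x <? y
... | yes _ = 0
... | no _ = suc (crossing ys (x ∸ y))

crossing-spec : ∀ xs x → x < sum xs →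
  crossing xs x < length xs × prefixSum xs (crossing xs x) ≤ x × x < prefixSum xs (suc (crossing xs x))
crossing-spec (y ∷ ys) x x<Σ with x <? y
... | yes x<y = z<s , z≤n , subst (x <_) (sym (+-identityʳ y)) x<y
... | no x≮y =
  let c< , P≤ , <P = crossing-spec ys (x ∸ y) (+-cancelˡ-< y _ _ (subst (_< y + sum ys) (sym x≡) x<Σ))
  in s≤s c< , subst (y + P c ≤_) x≡ (+-monoʳ-≤ y P≤) ,
     subst (_< y + P (suc c)) x≡ (+-monoʳ-< y <P)
  where
  P : ℕ → ℕ
  P = prefixSum ys
  c : ℕ
  c = crossing ys (x ∸ y)
  x≡ : y + (x ∸ y) ≡ x
  x≡ = m+[n∸m]≡n (≮⇒≥ x≮y)

module _ {M ps qs} (npb : NoProperBalance ps qs) (qs⁺ : All (0 <_) qs) (ps≤M : All (_≤ M) ps)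
         (Σps≡Σqs : sum ps ≡ sum qs) where

  private
    P Q : ℕ → ℕ
    P = prefixSum ps
    Q = prefixSum qs

    c : ℕ → ℕ
    c j = crossing ps (Q j)

    -- P (c j) ≤ Q j < P (suc (c j)) ≤ Q j + M, so the overshoot is suc (gap j) ∈ [1, M].
    gap : ℕ → ℕ
    gap j = P (suc (c j)) ∸ suc (Q j)

    module _ {j} (j< : j < length qs) where

      c-spec : c j < length ps × P (c j) ≤ Q j × Q j < P (suc (c j))
      c-spec = crossing-spec ps (Q j)
        (subst (Q j <_) (trans (prefixSum-length qs) (sym Σps≡Σqs)) (prefixSum-mono-< qs⁺ j< ≤-refl))

      c< : c j < length ps
      c< = proj₁ c-spec
      P[c]≤Q : P (c j) ≤ Q j
      P[c]≤Q = proj₁ (proj₂ c-spec)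
      Q<P[c+1] : Q j < P (suc (c j))
      Q<P[c+1] = proj₂ (proj₂ c-spec)

      P[c+1]≤Q+M : P (suc (c j)) ≤ Q j + M
      P[c+1]≤Q+M = ≤-trans (prefixSum-suc-≤ (c j) ps≤M) (+-monoˡ-≤ M P[c]≤Q)

      P[c+1]≡ : P (suc (c j)) ≡ suc (Q j) + gap j
      P[c+1]≡ = sym (m+[n∸m]≡n Q<P[c+1])

      gap<M : gap j < M
      gap<M = subst (gap j <_) (m+n∸m≡n (suc (Q j)) M) (∸-monoˡ-< (s≤s P[c+1]≤Q+M) Q<P[c+1])

      -- An overshoot of exactly M leaves P (c j) = Q j: balanced prefixes, so c j = j = 0.
      gap≡pred⇒head : .{{NonZero M}} → gap j ≡ ℕ.pred M → P 1 ≡ M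
      gap≡pred⇒head gap≡ = begin
        P 1              ≡⟨ cong (λ k → P (suc k)) (proj₁ trivial-prefixes) ⟩
        P (suc (c j))    ≡⟨ P[c+1]≡Q+M ⟩
        Q j + M          ≡⟨ cong (λ k → Q k + M) (sym (proj₂ trivial-prefixes)) ⟩
        M                ∎
        where
        open ≡-Reasoning
        P[c+1]≡Q+M : P (suc (c j)) ≡ Q j + M
        P[c+1]≡Q+M = trans P[c+1]≡ (trans (sym (+-suc (Q j) (gap j)))
                       (cong (_+_ (Q j)) (trans (cong suc gap≡) (suc-pred M))))
        P[c]≡Q : P (c j) ≡ Q j
        P[c]≡Q = ≤-antisym P[c]≤Q (+-cancelʳ-≤ M _ _
                   (subst (_≤ P (c j) + M) P[c+1]≡Q+M (prefixSum-suc-≤ (c j) ps≤M)))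
        trivial-prefixes : 0 ≡ c j × 0 ≡ j
        trivial-prefixes =
          balanced-prefixes⇒equal npb z≤n (<⇒≤ c<) z≤n j< (trans (+-identityʳ _) P[c]≡Q)

    -- Equal overshoots would balance ps[suc (c j), suc (c j′)) against qs[j, j′).
    gap-injective : ∀ {j j′} → j < j′ → j′ < length qs → gap j ≢ gap j′
    gap-injective {j} {j′} j<j′ j′< gap≡ = by-order (suc (c j) ≤? suc (c j′))
      where
      eq : P (suc (c j′)) + Q j ≡ P (suc (c j)) + Q j′
      eq = begin
        P (suc (c j′)) + Q j       ≡⟨ cong (_+ Q j) (P[c+1]≡ j′<) ⟩
        suc (Q j′) + gap j′ + Q j  ≡⟨ cong (λ g → suc (Q j′) + g + Q j) (sym gap≡) ⟩
        suc (Q j′) + gap j + Q j   ≡⟨ swap-ends (Q j′) (gap j) (Q j) ⟩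
        suc (Q j) + gap j + Q j′   ≡⟨ cong (_+ Q j′) (sym (P[c+1]≡ (<-trans j<j′ j′<))) ⟩
        P (suc (c j)) + Q j′       ∎
        where
        open ≡-Reasoning
        swap-ends : ∀ a g b → suc a + g + b ≡ suc b + g + a
        swap-ends = solve-∀
      by-order : Dec (suc (c j) ≤ suc (c j′)) → ⊥
      by-order (yes I≤I′) =
        <-irrefl (proj₂ (balanced-prefixes⇒equal npb I≤I′ (c< j′<) (<⇒≤ j<j′) j′< eq)) j<j′
      by-order (no I≰I′) =
        <-irrefl eq (+-mono-≤-< (prefixSum-mono-≤ ps (<⇒≤ (≰⇒> I≰I′)))
                                (prefixSum-mono-< qs⁺ j<j′ (<⇒≤ j′<)))

  length≤bound : length qs ≤ M
  length≤bound = injective⇒≤-ℕ gap gap<M gap-injective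

  length≡bound⇒head≡bound : .{{NonZero M}} → length qs ≡ M → prefixSum ps 1 ≡ M
  length≡bound⇒head≡bound |qs|≡M with P 1 ℕ.≟ M
  ... | yes P1≡M = P1≡M
  ... | no P1≢M =
    contradiction (m≤pred[n]⇒suc[m]≤n (subst (_≤ ℕ.pred M) |qs|≡M |qs|≤pred)) (<-irrefl refl)
    where
    |qs|≤pred : length qs ≤ ℕ.pred M
    |qs|≤pred = injective⇒≤-ℕ gap
      (λ j< → ≤∧≢⇒< (<⇒≤pred (gap<M j<)) (P1≢M ∘ gap≡pred⇒head j<)) gap-injective

-- Residues of prefix sums

m%n≡o%n⇒∃[k]o≡m+k*n : ∀ {m o n} .{{_ : NonZero n}} → m ≤ o → m % n ≡ o % n →
  ∃[ k ] (o ≡ m + k * n)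
m%n≡o%n⇒∃[k]o≡m+k*n {m} {o} {n} m≤o m%n≡o%n = k , (begin
  o                           ≡⟨ m≡m%n+[m/n]*n o n ⟩
  o % n + (o / n) * n         ≡⟨ cong₂ (λ r q → r + q * n) (sym m%n≡o%n)
                                        (sym (m+[n∸m]≡n (/-monoˡ-≤ n m≤o))) ⟩
  m % n + (m / n + k) * n     ≡⟨ regroup (m % n) (m / n) k n ⟩
  m % n + (m / n) * n + k * n ≡⟨ cong (_+ k * n) (sym (m≡m%n+[m/n]*n m n)) ⟩
  m + k * n                   ∎)
  where
  open ≡-Reasoning
  k : ℕ
  k = o / n ∸ m / n
  regroup : ∀ r q k n → r + (q + k) * n ≡ r + q * n + k * n
  regroup = solve-∀

prefixSum-% : ∀ {M c} .{{_ : NonZero M}} qs → All (λ y → y % M ≡ c % M) qs →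
  ∀ {k} → k ≤ length qs → prefixSum qs k % M ≡ (k * c) % M
prefixSum-% _ _ {zero} _ = refl
prefixSum-% {M} {c} (y ∷ qs) (y≡c ∷ qs≡c) {suc k} (s≤s k≤) = begin
  (y + prefixSum qs k) % M             ≡⟨ %-distribˡ-+ y _ M ⟩
  (y % M + prefixSum qs k % M) % M     ≡⟨ cong₂ (λ u v → (u + v) % M) y≡c
                                                  (prefixSum-% qs qs≡c k≤) ⟩
  (c % M + (k * c) % M) % M            ≡⟨ sym (%-distribˡ-+ c (k * c) M) ⟩
  (c + k * c) % M                      ∎
  where open ≡-Reasoning

-- Q j′ = Q j + t * M would balance t copies of M against qs[j, j′).
prefix-residues-distinct : ∀ {w M qs j j′} .{{_ : NonZero M}} → NoProperBalance (replicate w M) qs →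
  length qs ≡ M → sum qs ≡ w * M → j < j′ → j′ < M →
  prefixSum qs j % M ≢ prefixSum qs j′ % M
prefix-residues-distinct {w} {M} {qs} {j} {j′} npb |qs|≡M Σqs≡ j<j′ j′<M res≡ =
  <-irrefl (proj₂ (balanced-prefixes⇒equal npb z≤n t≤|ps| (<⇒≤ j<j′) j′<|qs| balanced)) j<j′
  where
  Qj≤Qj′ : prefixSum qs j ≤ prefixSum qs j′
  Qj≤Qj′ = prefixSum-mono-≤ qs (<⇒≤ j<j′)
  t : ℕ
  t = proj₁ (m%n≡o%n⇒∃[k]o≡m+k*n Qj≤Qj′ res≡)
  Qj′≡ : prefixSum qs j′ ≡ prefixSum qs j + t * M
  Qj′≡ = proj₂ (m%n≡o%n⇒∃[k]o≡m+k*n Qj≤Qj′ res≡)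
  j′<|qs| : j′ < length qs
  j′<|qs| = subst (j′ <_) (sym |qs|≡M) j′<M
  t≤w : t ≤ w
  t≤w = *-cancelʳ-≤ t w M (begin
    t * M                         ≤⟨ m≤n+m (t * M) _ ⟩
    prefixSum qs j + t * M        ≡⟨ sym Qj′≡ ⟩
    prefixSum qs j′               ≤⟨ prefixSum-mono-≤ qs (<⇒≤ j′<|qs|) ⟩
    prefixSum qs (length qs)      ≡⟨ prefixSum-length qs ⟩
    sum qs                        ≡⟨ Σqs≡ ⟩
    w * M                         ∎)
    where open ≤-Reasoning
  t≤|ps| : t ≤ length (replicate w M)
  t≤|ps| = subst (t ≤_) (sym (length-replicate w)) t≤w
  balanced : prefixSum (replicate w M) t + prefixSum qs j ≡ prefixSum qs j′
  balanced = trans (cong (_+ prefixSum qs j) (prefixSum-replicate M t≤w))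
                   (trans (+-comm (t * M) _) (sym Qj′≡))

neighbours-congruent : ∀ {w M x y rest} .{{_ : NonZero M}} →
  NoProperBalance (replicate w M) (x ∷ y ∷ rest) →
  length (x ∷ y ∷ rest) ≡ M → sum (x ∷ y ∷ rest) ≡ w * M → x % M ≡ y % M
neighbours-congruent {w} {M} {x} {y} {rest} npb |qs|≡M Σqs≡ with x % M ℕ.≟ y % M
... | yes x≡y = x≡y
... | no x≢y = contradiction (injective⇒≤-ℕ {n = suc M} f f<M f-injective) (<-irrefl refl)
  where
  qs qs′ : List ℕ
  qs  = x ∷ y ∷ rest
  qs′ = y ∷ x ∷ rest
  Q Q′ : ℕ → ℕ
  Q  = prefixSum qs
  Q′ = prefixSum qs′
  swap↭ : qs ↭ qs′
  swap↭ = swap x y ↭-refl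
  distinct : ∀ {j j′} → j < j′ → j′ < M → Q j % M ≢ Q j′ % M
  distinct = prefix-residues-distinct npb |qs|≡M Σqs≡
  distinct′ : ∀ {j j′} → j < j′ → j′ < M → Q′ j % M ≢ Q′ j′ % M
  distinct′ = prefix-residues-distinct (noProperBalance-resp-↭ ↭-refl swap↭ npb) |qs|≡M
                (trans (sym (sum-↭ swap↭)) Σqs≡)
  Q′1≡y : Q′ 1 ≡ y
  Q′1≡y = +-identityʳ y
  Q≡Q′ : ∀ k → Q (2 + k) ≡ Q′ (2 + k)
  Q≡Q′ k = swap-heads x y (prefixSum rest k)
    where
    swap-heads : ∀ a b c → a + (b + c) ≡ b + (a + c)
    swap-heads = solve-∀
  -- The prefix sums of qs and qs′ differ only at 1, so f is injective unless x ≡ y.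
  f : ℕ → ℕ
  f zero = y % M
  f (suc j) = Q j % M
  f<M : ∀ {i} → i < suc M → f i < M
  f<M {zero} _ = m%n<n y M
  f<M {suc j} _ = m%n<n (Q j) M
  f-injective : ∀ {i j} → i < j → j < suc M → f i ≢ f j
  f-injective {zero} {1} _ _ eq =
    distinct′ z<s (subst (1 <_) |qs|≡M (s≤s z<s)) (trans (sym eq) (cong (_% M) (sym Q′1≡y)))
  f-injective {zero} {2} _ _ eq = x≢y (sym (trans eq (cong (_% M) (+-identityʳ x))))
  f-injective {zero} {suc (suc (suc k))} _ (s≤s 2+k<M) eq =
    distinct′ (s≤s z<s) 2+k<M (trans (cong (_% M) Q′1≡y) (trans eq (cong (_% M) (Q≡Q′ k))))
  f-injective {suc i} {suc j} (s≤s i<j) (s≤s j<M) eq = distinct i<j j<M eq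

gcd≢1⇒small-annihilator : ∀ c M .{{_ : NonZero M}} → gcdℕ c M ≢ 1 →
  ∃[ k ] (0 < k × k < M × M ∣ k * c)
gcd≢1⇒small-annihilator c M gcd≢1
  with gcd[m,n]∣n c M | gcd[m,n]∣m c M
... | divides k M≡k*g | divides d c≡d*g = k , 0<k , k<M , divides d k*c≡d*M
  where
  g = gcdℕ c M
  0<k : 0 < k
  0<k = n≢0⇒n>0 λ { refl → ≢-nonZero⁻¹ M M≡k*g }
  1<g : 1 < g
  1<g = ≤∧≢⇒< (n≢0⇒n>0 (gcd[m,n]≢0 c M (inj₂ (≢-nonZero⁻¹ M)))) (gcd≢1 ∘ sym)
  k<M : k < M
  k<M = subst (k <_) (sym M≡k*g) (m<m*n k g {{>-nonZero 0<k}} 1<g)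
  k*c≡d*M : k * c ≡ d * M
  k*c≡d*M = begin
    k * c       ≡⟨ cong (k *_) c≡d*g ⟩
    k * (d * g) ≡⟨ swap-factors k d g ⟩
    d * (k * g) ≡⟨ cong (d *_) (sym M≡k*g) ⟩
    d * M       ∎
    where
    open ≡-Reasoning
    swap-factors : ∀ k d g → k * (d * g) ≡ d * (k * g)
    swap-factors = solve-∀

module _ {w M qs} .{{_ : NonZero M}} (npb : NoProperBalance (replicate w M) qs)
         (|qs|≡M : length qs ≡ M) (Σqs≡ : sum qs ≡ w * M) where

  congruent⇒coprime : ∀ {c} → All (λ y → y % M ≡ c % M) qs → gcdℕ c M ≡ 1
  congruent⇒coprime {c} qs≡c with gcdℕ c M ℕ.≟ 1
  ... | yes coprime = coprime
  ... | no gcd≢1 =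
    let k , 0<k , k<M , M∣k*c = gcd≢1⇒small-annihilator c M gcd≢1
    in contradiction (sym (trans (prefixSum-% qs qs≡c (subst (k ≤_) (sym |qs|≡M) (<⇒≤ k<M)))
                                 (trans (n∣m⇒m%n≡0 (k * c) M M∣k*c) (sym (m*n%n≡0 0 M)))))
                     (prefix-residues-distinct npb |qs|≡M Σqs≡ 0<k k<M)

  ∈⇒coprime : ∀ {x} → x ∈ qs → gcdℕ x M ≡ 1
  ∈⇒coprime {x} x∈qs with rest , qs↭ ← ∈⇒↭-front x∈qs =
    congruent⇒coprime (All-resp-↭ (↭-sym qs↭) (refl ∷ All.tabulate shares-residue))
    where
    shares-residue : ∀ {y} → y ∈ rest → y % M ≡ x % M
    shares-residue y∈rest with rest′ , rest↭ ← ∈⇒↭-front y∈rest =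
      sym (neighbours-congruent (noProperBalance-resp-↭ ↭-refl qs↭′ npb)
             (trans (sym (↭-length qs↭′)) |qs|≡M) (trans (sym (sum-↭ qs↭′)) Σqs≡))
      where
      qs↭′ : qs ↭ x ∷ _ ∷ rest′
      qs↭′ = ↭-trans qs↭ (prep x rest↭)

-- Extremal pairs

extremal-shape : ∀ {m M ps qs} .{{_ : NonZero M}} → gcdℕ (suc m) M ≢ 1 → NoProperBalance ps qs →
  All (_≤ M) ps → All (0 <_) qs → All (_≤ suc m) qs →
  length ps ≡ m → length qs ≡ M → sum ps ≡ sum qs →
  ps ≡ replicate m M × qs ≡ replicate M m × gcdℕ m M ≡ 1
extremal-shape {m} {M} {ps} {qs} gcd≢1 npb ps≤M qs⁺ qs≤1+m |ps|≡m |qs|≡M Σps≡Σqs =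
  ps≡ , qs≡ , congruent⇒coprime npb′ |qs|≡M Σqs≡ (All.map (cong (_% M)) qs≡m)
  where
  starts-with-M : ∀ {x} → x ∈ ps → x ≡ M
  starts-with-M {x} x∈ps with rest , ps↭ ← ∈⇒↭-front x∈ps =
    trans (sym (+-identityʳ x))
      (length≡bound⇒head≡bound (noProperBalance-resp-↭ ps↭ ↭-refl npb) qs⁺ (All-resp-↭ ps↭ ps≤M)
        (trans (sym (sum-↭ ps↭)) Σps≡Σqs) |qs|≡M)
  ps≡ : ps ≡ replicate m M
  ps≡ = trans (All≡⇒≡replicate ps (All.tabulate starts-with-M)) (cong (λ n → replicate n M) |ps|≡m)
  npb′ : NoProperBalance (replicate m M) qs
  npb′ = subst (λ ps → NoProperBalance ps qs) ps≡ npb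
  Σqs≡ : sum qs ≡ m * M
  Σqs≡ = trans (sym Σps≡Σqs) (trans (cong sum ps≡) (sum-replicate m M))
  qs≤m : All (_≤ m) qs
  qs≤m = All.tabulate λ y∈qs → ℕ.s≤s⁻¹ (≤∧≢⇒< (All.lookup qs≤1+m y∈qs)
           λ { refl → gcd≢1 (∈⇒coprime npb′ |qs|≡M Σqs≡ y∈qs) })
  qs≡m : All (_≡ m) qs
  qs≡m = sum≡length*⇒All≡ qs qs≤m (trans Σqs≡ (trans (*-comm m M) (cong (_* m) (sym |qs|≡M))))
  qs≡ : qs ≡ replicate M m
  qs≡ = trans (All≡⇒≡replicate qs qs≡m) (cong (λ n → replicate n m) |qs|≡M)

extremal-lengths : ∀ {m M a b} → a ≤ suc m → b ≤ suc M → a + b ≡ m + suc M →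
  (a ≡ m × b ≡ suc M) ⊎ (a ≡ suc m × b ≡ M)
extremal-lengths {m} {M} {a} {b} a≤1+m b≤1+M a+b≡ with m≤n⇒m<n∨m≡n b≤1+M
... | inj₂ refl = inj₁ (+-cancelʳ-≡ (suc M) a m a+b≡ , refl)
... | inj₁ b<1+M =
  inj₂ (a≡1+m , +-cancelˡ-≡ a b M (trans a+b≡ (trans (+-suc m M) (cong (_+ M) (sym a≡1+m)))))
  where
  a≡1+m : a ≡ suc m
  a≡1+m = ≤-antisym a≤1+m (+-cancelʳ-≤ M (suc m) a
            (subst (_≤ a + M) (trans a+b≡ (+-suc m M)) (+-monoʳ-≤ a (ℕ.s≤s⁻¹ b<1+M))))

extremal-classification : ∀ {m M ps qs} → gcdℕ (suc m) (suc M) ≢ 1 → NoProperBalance ps qs →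
  All (0 <_) ps → All (_≤ suc M) ps → All (0 <_) qs → All (_≤ suc m) qs →
  length ps + length qs ≡ m + suc M → sum ps ≡ sum qs →
  (ps ≡ replicate m (suc M) × qs ≡ replicate (suc M) m × gcdℕ m (suc M) ≡ 1) ⊎
  (ps ≡ replicate (suc m) M × qs ≡ replicate M (suc m) × gcdℕ (suc m) M ≡ 1)
extremal-classification {m} {M} gcd≢1 npb ps⁺ ps≤ qs⁺ qs≤ |ps|+|qs|≡ Σps≡Σqs
  with extremal-lengths (length≤bound (noProperBalance-sym npb) ps⁺ qs≤ (sym Σps≡Σqs))
                        (length≤bound npb qs⁺ ps≤ Σps≡Σqs) |ps|+|qs|≡
... | inj₁ (|ps|≡m , |qs|≡1+M) = inj₁ (extremal-shape gcd≢1 npb ps≤ qs⁺ qs≤ |ps|≡m |qs|≡1+M Σps≡Σqs)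
... | inj₂ (|ps|≡1+m , |qs|≡M) =
  let qs≡ , ps≡ , coprime = extremal-shape (gcd≢1 ∘ trans (gcdℕ-comm (suc m) (suc M)))
                              (noProperBalance-sym npb) qs≤ ps⁺ ps≤ |qs|≡M |ps|≡1+m (sym Σps≡Σqs)
  in inj₂ (ps≡ , qs≡ , trans (gcdℕ-comm (suc m) M) coprime)

-- Sequences of integers

sumℤ-↭ : ∀ {xs ys} → xs ↭ ys → sumℤ xs ≡ sumℤ ys
sumℤ-↭ xs↭ys = foldr-commMonoid (setoid ℤ) ℤ.+-0-isCommutativeMonoid (↭⇒↭ₛ xs↭ys)

sumℤ-++ : ∀ xs ys → sumℤ (xs ++ ys) ≡ sumℤ xs ℤ.+ sumℤ ys
sumℤ-++ [] ys = sym (ℤ.+-identityˡ _)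
sumℤ-++ (x ∷ xs) ys = trans (cong (ℤ._+_ x) (sumℤ-++ xs ys)) (sym (ℤ.+-assoc x _ _))

minimal-resp-↭ : ∀ {S S′} → S ↭ S′ → MinimalZeroSum S → MinimalZeroSum S′
minimal-resp-↭ S↭S′ (zero-sum , minimal) =
  trans (sym (sumℤ-↭ S↭S′)) zero-sum ,
  λ T T⊆S′ 0<|T| |T|<|S′| T-zero-sum →
    let T′ , T′⊆S , T′↭T = ⊆-↭-commute (↭-sym S↭S′) T⊆S′
    in minimal T′ T′⊆S (subst (0 <_) (sym (↭-length T′↭T)) 0<|T|)
         (subst₂ _<_ (sym (↭-length T′↭T)) (sym (↭-length S↭S′)) |T|<|S′|)
         (trans (sumℤ-↭ T′↭T) T-zero-sum)

minimal⇒nonzero : ∀ {S} → MinimalZeroSum S → 1 < length S → All (_≢ 0ℤ) S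
minimal⇒nonzero (_ , minimal) 1<|S| =
  All.tabulate λ {x} x∈S x≡0 → minimal [ x ] (from∈ x∈S) z<s 1<|S| (trans (ℤ.+-identityʳ x) x≡0)

signed : List ℕ → List ℕ → Sequence
signed ps qs = map +_ ps ++ map (-_ ∘ +_) qs

length-signed : ∀ ps qs → length (signed ps qs) ≡ length ps + length qs
length-signed ps qs = trans (length-++ (map +_ ps)) (cong₂ _+_ (length-map +_ ps) (length-map _ qs))

sumℤ-signed : ∀ ps qs → sumℤ (signed ps qs) ≡ + sum ps ℤ.- + sum qs
sumℤ-signed ps qs = trans (sumℤ-++ (map +_ ps) _) (cong₂ ℤ._+_ (positives ps) (negatives qs))
  where
  positives : ∀ ps → sumℤ (map +_ ps) ≡ + sum ps
  positives [] = refl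
  positives (p ∷ ps) = trans (cong (ℤ._+_ (+ p)) (positives ps)) (sym (ℤ.pos-+ p (sum ps)))
  negatives : ∀ qs → sumℤ (map (-_ ∘ +_) qs) ≡ - + sum qs
  negatives [] = refl
  negatives (q ∷ qs) = trans (cong (ℤ._+_ (- + q)) (negatives qs))
    (sym (trans (cong -_ (ℤ.pos-+ q (sum qs))) (ℤ.neg-distrib-+ (+ q) (+ sum qs))))

zeroSum-signed⁺ : ∀ ps qs → sum ps ≡ sum qs → ZeroSum (signed ps qs)
zeroSum-signed⁺ ps qs Σps≡Σqs = trans (sumℤ-signed ps qs) (ℤ.i≡j⇒i-j≡0 (cong +_ Σps≡Σqs))

zeroSum-signed⁻ : ∀ ps qs → ZeroSum (signed ps qs) → sum ps ≡ sum qs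
zeroSum-signed⁻ ps qs zero-sum =
  ℤ.+-injective (ℤ.i-j≡0⇒i≡j _ _ (trans (sym (sumℤ-signed ps qs)) zero-sum))

signed-⊆⁺ : ∀ {as ps bs qs} → as ⊆ ps → bs ⊆ qs → signed as bs ⊆ signed ps qs
signed-⊆⁺ as⊆ps bs⊆qs = ++⁺ (map⁺ +_ as⊆ps) (map⁺ _ bs⊆qs)

signed-⊆⁻ : ∀ {T ps qs} → T ⊆ signed ps qs →
  ∃[ as ] ∃[ bs ] (as ⊆ ps × bs ⊆ qs × T ≡ signed as bs)
signed-⊆⁻ {ps = ps} T⊆ =
  let T₁ , T₂ , T₁⊆ , T₂⊆ , T≡ = ⊆-++⁻ (map +_ ps) T⊆
      as , as⊆ps , T₁≡ = ⊆-map⁻ +_ T₁⊆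
      bs , bs⊆qs , T₂≡ = ⊆-map⁻ (-_ ∘ +_) T₂⊆
  in as , bs , as⊆ps , bs⊆qs , trans T≡ (cong₂ _++_ T₁≡ T₂≡)

minimal⇒noProperBalance : ∀ {ps qs} → MinimalZeroSum (signed ps qs) →
  NoProperBalance ps qs × sum ps ≡ sum qs
minimal⇒noProperBalance {ps} {qs} (zero-sum , minimal) = npb , zeroSum-signed⁻ ps qs zero-sum
  where
  npb : NoProperBalance ps qs
  npb {as} {bs} as⊆ps bs⊆qs Σas≡Σbs short = n≤0⇒n≡0 (≮⇒≥ λ 0<|as|+|bs| →
    minimal (signed as bs) (signed-⊆⁺ as⊆ps bs⊆qs)
      (subst (0 <_) (sym (length-signed as bs)) 0<|as|+|bs|)
      (subst₂ _<_ (sym (length-signed as bs)) (sym (length-signed ps qs)) short)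
      (zeroSum-signed⁺ as bs Σas≡Σbs))

noProperBalance⇒minimal : ∀ {ps qs} → NoProperBalance ps qs → sum ps ≡ sum qs →
  MinimalZeroSum (signed ps qs)
noProperBalance⇒minimal {ps} {qs} npb Σps≡Σqs = zeroSum-signed⁺ ps qs Σps≡Σqs , minimal
  where
  minimal : ∀ T → T ⊆ signed ps qs → 0 < length T → length T < length (signed ps qs) → ¬ ZeroSum T
  minimal T T⊆ 0<|T| |T|< zero-sum with as , bs , as⊆ps , bs⊆qs , refl ← signed-⊆⁻ T⊆ =
    <-irrefl (sym (npb as⊆ps bs⊆qs (zeroSum-signed⁻ as bs zero-sum)
                (subst₂ _<_ (length-signed as bs) (length-signed ps qs) |T|<)))
             (subst (0 <_) (length-signed as bs) 0<|T|)

split-signs : ∀ {m M} S → Over (- + m) (+ M) S → All (_≢ 0ℤ) S →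
  ∃[ ps ] ∃[ qs ] (S ↭ signed ps qs ×
                   All (0 <_) ps × All (_≤ M) ps × All (0 <_) qs × All (_≤ m) qs)
split-signs [] [] [] = [] , [] , ↭-refl , [] , [] , [] , []
split-signs (+ zero ∷ _) _ (x≢0 ∷ _) = contradiction refl x≢0
split-signs (+[1+ k ] ∷ S) ((_ , x≤M) ∷ over) (_ ∷ S≢0) =
  let ps , qs , S↭ , ps⁺ , ps≤M , qs⁺ , qs≤m = split-signs S over S≢0
  in suc k ∷ ps , qs , prep _ S↭ , z<s ∷ ps⁺ , ℤ.drop‿+≤+ x≤M ∷ ps≤M , qs⁺ , qs≤m
split-signs {m} (-[1+ k ] ∷ S) ((-m≤x , _) ∷ over) (_ ∷ S≢0) =
  let ps , qs , S↭ , ps⁺ , ps≤M , qs⁺ , qs≤m = split-signs S over S≢0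
  in ps , suc k ∷ qs , ↭-trans (prep _ S↭) (↭-sym (shift -[1+ k ] (map +_ ps) _)) ,
     ps⁺ , ps≤M , z<s ∷ qs⁺ , ℤ.drop‿+≤+ (ℤ.neg-cancel-≤ {+ m} { +[1+ k ]} -m≤x) ∷ qs≤m

signed-over : ∀ {m M ps qs} → All (_≤ M) ps → All (_≤ m) qs → Over (- + m) (+ M) (signed ps qs)
signed-over ps≤M qs≤m =
  All.++⁺ (All.map⁺ (All.map (λ p≤M → ℤ.neg-≤-pos , ℤ.+≤+ p≤M) ps≤M))
          (All.map⁺ (All.map (λ q≤m → ℤ.neg-mono-≤ (ℤ.+≤+ q≤m) , ℤ.neg-≤-pos) qs≤m))

signed-replicate : ∀ a x b y → signed (replicate a x) (replicate b y) ≡ (+ x) ^^ a ++ (- (+ y)) ^^ b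
signed-replicate a x b y = cong₂ _++_ (map-replicate +_ a x) (map-replicate (-_ ∘ +_) b y)

coprime⇒davenport≥ : ∀ {m M d} .{{_ : NonZero m}} → DavenportIs m M d → gcdℕ m M ≡ 1 → m + M ≤ d
coprime⇒davenport≥ {m} {M} (_ , maximal) coprime = subst (_≤ _) |S|≡m+M
  (maximal S (signed-over (All.replicate⁺ m ≤-refl) (All.replicate⁺ M ≤-refl))
    (noProperBalance⇒minimal (coprime⇒noProperBalance coprime)
      (trans (sum-replicate m M) (trans (*-comm m M) (sym (sum-replicate M m))))))
  where
  S : Sequence
  S = signed (replicate m M) (replicate M m)
  |S|≡m+M : length S ≡ m + M
  |S|≡m+M = trans (length-signed (replicate m M) (replicate M m))
                  (cong₂ _+_ (length-replicate m) (length-replicate M))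

extremal-sequences : ∀ {m M} → gcdℕ (suc m) (suc M) ≢ 1 →
  ∀ S → Over (- + suc m) (+ suc M) S → MinimalZeroSum S → length S ≡ m + suc M →
  (S ↭ (+ suc M) ^^ m ++ (- (+ m)) ^^ suc M × gcd (+ m) (+ suc M) ≡ + 1) ⊎
  (S ↭ (+ M) ^^ suc m ++ (- (+ suc m)) ^^ M × gcd (+ suc m) (+ M) ≡ + 1)
extremal-sequences {zero} {M} gcd≢1 _ _ _ _ = contradiction (gcd-zeroˡ (suc M)) gcd≢1
extremal-sequences {suc m} {M} gcd≢1 S over minimal |S|≡
  with ps , qs , S↭ , ps⁺ , ps≤ , qs⁺ , qs≤ ← split-signs S over (minimal⇒nonzero minimal
         (subst (1 <_) (sym |S|≡) (s≤s (≤-trans (s≤s z≤n) (m≤n+m (suc M) m)))))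
  with npb , Σps≡Σqs ← minimal⇒noProperBalance (minimal-resp-↭ S↭ minimal)
  with extremal-classification {ps = ps} {qs} gcd≢1 npb ps⁺ ps≤ qs⁺ qs≤
         (trans (sym (length-signed ps qs)) (trans (sym (↭-length S↭)) |S|≡)) Σps≡Σqs
... | inj₁ (refl , refl , coprime) =
  inj₁ (subst (S ↭_) (signed-replicate (suc m) (suc M) (suc M) (suc m)) S↭ , cong +_ coprime)
... | inj₂ (refl , refl , coprime) =
  inj₂ (subst (S ↭_) (signed-replicate (suc (suc m)) M M (suc (suc m))) S↭ , cong +_ coprime)

-- The invariant ρ(m, M)

+m-+n≡+[m∸n] : ∀ m {n} → n ≤ m → + m ℤ.- + n ≡ + (m ∸ n)
+m-+n≡+[m∸n] m {n} n≤m = trans (ℤ.[+m]-[+n]≡m⊖n m n) (ℤ.⊖-≥ n≤m)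

rho≡1 : ∀ {m M} → gcdℕ (suc m) (suc M) ≢ 1 →
  gcd (+ m) (+ suc M) ≡ + 1 ⊎ gcd (+ suc m) (+ M) ≡ + 1 → RhoIs (suc m) (suc M) 1
rho≡1 {m} {M} gcd≢1 shifted-coprime = condition-at-1 shifted-coprime , no-condition-at-0
  where
  condition-at-1 : gcd (+ m) (+ suc M) ≡ + 1 ⊎ gcd (+ suc m) (+ M) ≡ + 1 → RhoCond (suc m) (suc M) 1
  condition-at-1 (inj₁ coprime) = 0 , z≤n ,
    trans (cong₂ gcd (+m-+n≡+[m∸n] (suc M) z≤n) (+m-+n≡+[m∸n] (suc m) (s≤s z≤n)))
          (trans (gcdℤ-comm (+ suc M) (+ m)) coprime)
  condition-at-1 (inj₂ coprime) = 1 , ≤-refl ,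
    trans (cong₂ gcd (+m-+n≡+[m∸n] (suc M) (s≤s z≤n)) (+m-+n≡+[m∸n] (suc m) z≤n))
          (trans (gcdℤ-comm (+ M) (+ suc m)) coprime)
  no-condition-at-0 : ∀ t → t < 1 → ¬ RhoCond (suc m) (suc M) t
  no-condition-at-0 zero _ (zero , _ , coprime) = gcd≢1 (trans (gcdℕ-comm (suc m) (suc M))
    (ℤ.+-injective (trans (sym (cong₂ gcd (+m-+n≡+[m∸n] (suc M) z≤n) (+m-+n≡+[m∸n] (suc m) z≤n)))
                          coprime)))
  no-condition-at-0 zero _ (suc _ , () , _)
  no-condition-at-0 (suc _) (s≤s ()) _

proposition3p11 : (m M : ℕ) → 0 ℕ.< m → 0 ℕ.< M →
    DavenportIs m M (m + M ∸ 1) →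
    RhoIs m M 1 ×
    ((S : Sequence) → Over (- (+ m)) (+ M) S → MinimalZeroSum S → length S ≡ m + M ∸ 1 →
      (S ↭ ((+ M) ^^ (m ∸ 1) ++ (- (+ (m ∸ 1))) ^^ M) × gcd (+ (m ∸ 1)) (+ M) ≡ + 1)
      ⊎ (S ↭ ((+ (M ∸ 1)) ^^ m ++ (- (+ m)) ^^ (M ∸ 1)) × gcd (+ m) (+ (M ∸ 1)) ≡ + 1))
proposition3p11 (suc m) (suc M) _ _ D@((S , over , minimal , |S|≡) , _) =
  rho≡1 gcd≢1 (Sum.map proj₂ proj₂ (extremal-sequences gcd≢1 S over minimal |S|≡)) ,
  extremal-sequences gcd≢1
  where
  gcd≢1 : gcdℕ (suc m) (suc M) ≢ 1
  gcd≢1 coprime = <-irrefl refl (coprime⇒davenport≥ D coprime)
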